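{- Let $\Lambda$ be a numerical semigroup of genus $g\geq 1$ and conductor $c$, and let $e(1),\dots,e(2g)$ be the steps of its square diagram. Then $\Lambda$ is symmetric (i.e. $c=2g$) if and only if $e(2g-1)=\uparrow$.
   Context: A numerical semigroup is a subset $\Lambda\subseteq\mathbb{N}_0$ containing $0$, closed under addition, with finite complement in $\mathbb{N}_0$; elements of $\mathbb{N}_0\setminus\Lambda$ are gaps and their number is the genus $g$. For $g\geq 1$, the conductor $c$ is the unique element $c\in\Lambda$ with $c-1\notin\Lambda$ and $c+\mathbb{N}_0\subseteq\Lambda$. $\Lambda$ is called symmetric if $c=2g$. The square diagram $\tau(\Lambda)$ is the lattice path starting at $(0,0)$ with steps $e(i)$, $1\le i\le 2g$, where $e(i)=\rightarrow=(1,0)$ if $i\in\Lambda$ and $e(i)=\uparrow=(0,1)$ if $i\notin\Lambda$. -}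

module Defs where

open import Data.Nat using (ℕ; zero; suc; _+_; _*_; _∸_; _≤_)
open import Data.Bool using (Bool; true; false)
open import Data.Product using (Σ; _×_; ∃-syntax)
open import Relation.Nullary using (¬_)
open import Relation.Binary.PropositionalEquality using (_≡_)

record NumericalSemigroup : Set where
  field
    mem       : ℕ → Bool
    zero-mem  : mem 0 ≡ true
    closed    : ∀ m n → mem m ≡ true → mem n ≡ true → mem (m + n) ≡ true
    cofinite  : ∃[ N ] (∀ n → N ≤ n → mem n ≡ true)

open NumericalSemigroup public

_∈Λ_ : ℕ → NumericalSemigroup → Set
n ∈Λ Λ = mem Λ n ≡ true

gapsBelow : NumericalSemigroup → ℕ → ℕ
gapsBelow Λ zero = 0
gapsBelow Λ (suc N) with mem Λ N
... | true  = gapsBelow Λ N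
... | false = suc (gapsBelow Λ N)

HasGenus : NumericalSemigroup → ℕ → Set
HasGenus Λ g = ∃[ N ] ((∀ n → N ≤ n → n ∈Λ Λ) × gapsBelow Λ N ≡ g)

IsConductor : NumericalSemigroup → ℕ → Set
IsConductor Λ c = (1 ≤ c) × (c ∈Λ Λ) × (¬ ((c ∸ 1) ∈Λ Λ)) × (∀ n → c ≤ n → n ∈Λ Λ)

Symmetric : (g c : ℕ) → Set
Symmetric g c = c ≡ 2 * g

data Step : Set where
  right up : Step

e : NumericalSemigroup → ℕ → Step
e Λ i with mem Λ i
... | true  = right
... | false = up

-- For x < c the elements x and c − 1 − x cannot both lie in Λ, since their
-- sum c − 1 is a gap. Summing over x < c the number of gaps in {x, c − 1 − x}
-- counts every gap twice (all gaps lie below c), and each term is ≥ 1, so c ≤ 2g.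
-- Now c − 1 is always a gap, so c = 2g gives e(2g − 1) = ↑; conversely, if
-- 2g − 1 is a gap then 2g − 1 < c, i.e. 2g ≤ c, and hence c = 2g.
module Submission where

open import Defs
open import Data.Nat using (ℕ; zero; suc; _+_; _*_; _∸_; _≤_; _<_; _⊔_; z≤n; s≤s)
open import Data.Nat.Properties
open import Data.Bool using (true; false; if_then_else_)
open import Data.Product using (_,_)
open import Data.Sum using (inj₁; inj₂)
open import Data.Empty using (⊥-elim)
open import Function.Bundles using (_⇔_; mk⇔; Equivalence)
open import Relation.Nullary using (¬_)
open import Relation.Binary.PropositionalEquality
  using (_≡_; refl; sym; trans; cong; cong₂; subst; module ≡-Reasoning)
open import Algebra.Properties.CommutativeSemigroup +-commutativeSemigroup
  using (interchange; x∙yz≈y∙xz)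

sumBelow : ℕ → (ℕ → ℕ) → ℕ
sumBelow zero    f = 0
sumBelow (suc n) f = f n + sumBelow n f

sumBelow-cong : ∀ n {f h : ℕ → ℕ} → (∀ x → x < n → f x ≡ h x) →
                sumBelow n f ≡ sumBelow n h
sumBelow-cong zero    f≡h = refl
sumBelow-cong (suc n) f≡h =
  cong₂ _+_ (f≡h n ≤-refl) (sumBelow-cong n (λ x x<n → f≡h x (m<n⇒m<1+n x<n)))

sumBelow-+ : ∀ n (f h : ℕ → ℕ) →
             sumBelow n f + sumBelow n h ≡ sumBelow n (λ x → f x + h x)
sumBelow-+ zero    f h = refl
sumBelow-+ (suc n) f h = begin
  (f n + sumBelow n f) + (h n + sumBelow n h)  ≡⟨ interchange (f n) _ (h n) _ ⟩
  (f n + h n) + (sumBelow n f + sumBelow n h)  ≡⟨ cong (f n + h n +_) (sumBelow-+ n f h) ⟩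
  (f n + h n) + sumBelow n (λ x → f x + h x)   ∎
  where open ≡-Reasoning

sumBelow-suc-shift : ∀ n (f : ℕ → ℕ) →
                     sumBelow (suc n) f ≡ f 0 + sumBelow n (λ x → f (suc x))
sumBelow-suc-shift zero    f = refl
sumBelow-suc-shift (suc n) f = begin
  f (suc n) + (f n + sumBelow n f)                     ≡⟨ cong (f (suc n) +_) (sumBelow-suc-shift n f) ⟩
  f (suc n) + (f 0 + sumBelow n (λ x → f (suc x)))     ≡⟨ x∙yz≈y∙xz (f (suc n)) (f 0) _ ⟩
  f 0 + (f (suc n) + sumBelow n (λ x → f (suc x)))     ∎
  where open ≡-Reasoning

sumBelow-reverse : ∀ n (f : ℕ → ℕ) → sumBelow n (λ x → f (n ∸ suc x)) ≡ sumBelow n f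
sumBelow-reverse zero    f = refl
sumBelow-reverse (suc n) f = begin
  f (n ∸ n) + sumBelow n (λ x → f (n ∸ x))           ≡⟨ cong (λ k → f k + sumBelow n (λ x → f (n ∸ x))) (n∸n≡0 n) ⟩
  f 0 + sumBelow n (λ x → f (n ∸ x))                 ≡⟨ cong (f 0 +_) (sumBelow-cong n (λ x x<n → cong f (+-∸-assoc 1 x<n))) ⟩
  f 0 + sumBelow n (λ x → f (suc (n ∸ suc x)))       ≡⟨ cong (f 0 +_) (sumBelow-reverse n (λ y → f (suc y))) ⟩
  f 0 + sumBelow n (λ x → f (suc x))                 ≡⟨ sym (sumBelow-suc-shift n f) ⟩
  sumBelow (suc n) f                                 ∎
  where open ≡-Reasoning

n≤sumBelow : ∀ n {f : ℕ → ℕ} → (∀ x → x < n → 1 ≤ f x) → n ≤ sumBelow n f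
n≤sumBelow zero    pos = z≤n
n≤sumBelow (suc n) pos = +-mono-≤ (pos n ≤-refl) (n≤sumBelow n (λ x x<n → pos x (m<n⇒m<1+n x<n)))

m∸1<n⇒m≤n : ∀ {m n} → m ∸ 1 < n → m ≤ n
m∸1<n⇒m≤n {zero}  _   = z≤n
m∸1<n⇒m≤n {suc m} m<n = m<n

gapIndicator : NumericalSemigroup → ℕ → ℕ
gapIndicator Λ x = if mem Λ x then 0 else 1

gapsBelow≡sumBelow : ∀ Λ N → gapsBelow Λ N ≡ sumBelow N (gapIndicator Λ)
gapsBelow≡sumBelow Λ zero = refl
gapsBelow≡sumBelow Λ (suc N) with mem Λ N
... | true  = gapsBelow≡sumBelow Λ N
... | false = cong suc (gapsBelow≡sumBelow Λ N)

gapsBelow-stable : ∀ {Λ M} → (∀ n → M ≤ n → n ∈Λ Λ) →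
                   ∀ {N} → M ≤ N → gapsBelow Λ N ≡ gapsBelow Λ M
gapsBelow-stable {Λ} {M} tail {N} M≤N with m≤n⇒m<n∨m≡n M≤N
... | inj₂ refl = refl
gapsBelow-stable {Λ} {M} tail {suc N} _ | inj₁ (s≤s M≤N)
  rewrite tail N M≤N = gapsBelow-stable tail M≤N

gapsBelow-conductor : ∀ {Λ g c} → HasGenus Λ g → IsConductor Λ c → gapsBelow Λ c ≡ g
gapsBelow-conductor {Λ} {g} {c} (N , tailN , genus) (_ , _ , _ , tailc) = begin
  gapsBelow Λ c        ≡⟨ sym (gapsBelow-stable tailc (m≤n⊔m N c)) ⟩
  gapsBelow Λ (N ⊔ c)  ≡⟨ gapsBelow-stable tailN (m≤m⊔n N c) ⟩
  gapsBelow Λ N        ≡⟨ genus ⟩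
  g                    ∎
  where open ≡-Reasoning

conductor-pair-has-gap : ∀ {Λ c} → IsConductor Λ c → ∀ x → x < c →
                         1 ≤ gapIndicator Λ x + gapIndicator Λ (c ∸ suc x)
conductor-pair-has-gap {Λ} {suc c} (_ , _ , c∸1∉Λ , _) x (s≤s x≤c)
  with mem Λ x in x∈Λ | mem Λ (c ∸ x) in c∸x∈Λ
... | false | _     = s≤s z≤n
... | true  | false = s≤s z≤n
... | true  | true  =
  ⊥-elim (c∸1∉Λ (subst (_∈Λ Λ) (m+[n∸m]≡n x≤c) (closed Λ x (c ∸ x) x∈Λ c∸x∈Λ)))

conductor≤2*genus : ∀ {Λ g c} → HasGenus Λ g → IsConductor Λ c → c ≤ 2 * g
conductor≤2*genus {Λ} {g} {c} hasGenus isConductor = begin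
  c                                                   ≤⟨ n≤sumBelow c (conductor-pair-has-gap {Λ} isConductor) ⟩
  sumBelow c (λ x → gap x + gap (c ∸ suc x))          ≡⟨ sym (sumBelow-+ c gap (λ x → gap (c ∸ suc x))) ⟩
  sumBelow c gap + sumBelow c (λ x → gap (c ∸ suc x)) ≡⟨ cong (sumBelow c gap +_) (sumBelow-reverse c gap) ⟩
  sumBelow c gap + sumBelow c gap                     ≡⟨ cong (λ k → k + k) gaps≡g ⟩
  g + g                                               ≡⟨ cong (g +_) (sym (+-identityʳ g)) ⟩
  2 * g                                               ∎
  where
  open ≤-Reasoning
  gap = gapIndicator Λ
  gaps≡g : sumBelow c gap ≡ g
  gaps≡g = trans (sym (gapsBelow≡sumBelow Λ c)) (gapsBelow-conductor hasGenus isConductor)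

gap<conductor : ∀ {Λ c n} → IsConductor Λ c → ¬ n ∈Λ Λ → n < c
gap<conductor (_ , _ , _ , tail) n∉Λ = ≰⇒> (λ c≤n → n∉Λ (tail _ c≤n))

e≡up⇔∉ : ∀ Λ i → (e Λ i ≡ up) ⇔ (¬ i ∈Λ Λ)
e≡up⇔∉ Λ i with mem Λ i
... | true  = mk⇔ (λ ()) (λ i∉Λ → ⊥-elim (i∉Λ refl))
... | false = mk⇔ (λ _ ()) (λ _ → refl)

mainTheorem1 : (Λ : NumericalSemigroup) (g c : ℕ) → 1 ≤ g → HasGenus Λ g → IsConductor Λ c →
    (Symmetric g c ⇔ (e Λ (2 * g ∸ 1) ≡ up))
mainTheorem1 Λ g c _ hasGenus isConductor@(_ , _ , c∸1∉Λ , _) = mk⇔ symmetric⇒up up⇒symmetric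
  where
  open Equivalence
  symmetric⇒up : Symmetric g c → e Λ (2 * g ∸ 1) ≡ up
  symmetric⇒up c≡2g =
    subst (λ k → e Λ (k ∸ 1) ≡ up) c≡2g (from (e≡up⇔∉ Λ (c ∸ 1)) c∸1∉Λ)
  up⇒symmetric : e Λ (2 * g ∸ 1) ≡ up → Symmetric g c
  up⇒symmetric e≡up =
    ≤-antisym (conductor≤2*genus hasGenus isConductor)
              (m∸1<n⇒m≤n (gap<conductor {Λ} isConductor (to (e≡up⇔∉ Λ (2 * g ∸ 1)) e≡up)))
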